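{- Let $a\geq 3$ and $m\geq 2a^2-a+2$ be integers, let $C(m,a)=\left\lceil\frac{m-1}{a}\left\lceil\frac{m-1}{a}\right\rceil\right\rceil$, and suppose the set $\{1,\ldots,C(m,a)\}$ is colored red and blue so that there is no monochromatic solution of $x_1+\cdots+x_{m-1}=ax_m$, with both $a-2$ and $a-1$ red. Then each of $m-1$, $m-2$, $m-3$ is blue, and $a$ is red.
   Context: A solution is an assignment of values in $\{1,\ldots,C(m,a)\}$ to $x_1,\ldots,x_m$ (not necessarily distinct) making the equation true; it is monochromatic if all the values $x_1,\ldots,x_m$ have the same color. -}

module Defs where

open import Data.Nat using (ℕ; zero; suc; _+_; _*_; _∸_; _≤_; _/_; NonZero)
open import Data.Fin using (Fin)
open import Data.Bool using (Bool; true; false)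
open import Data.Product using (_×_)
import Data.Product
open import Relation.Binary.PropositionalEquality using (_≡_)

⌈_/_⌉ : (n a : ℕ) → .{{NonZero a}} → ℕ
⌈ n / a ⌉ = (n + (a ∸ 1)) / a

-- C(m,a) = ⌈ ((m-1)/a) · ⌈ (m-1)/a ⌉ ⌉ = ⌈ (m-1)·⌈(m-1)/a⌉ / a ⌉
-- (a is assumed ≥ 1 wherever C is used; then suc (a ∸ 1) = a)
C : (m a : ℕ) → ℕ
C m a = ⌈ (m ∸ 1) * ⌈ (m ∸ 1) / suc (a ∸ 1) ⌉ / suc (a ∸ 1) ⌉

data Colour : Set where
  red blue : Colour

ΣFin : (k : ℕ) → (Fin k → ℕ) → ℕ
ΣFin zero f = 0
ΣFin (suc k) f = f Fin.zero + ΣFin k (λ i → f (Fin.suc i))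

InRange : ℕ → ℕ → Set
InRange N x = (1 ≤ x) × (x ≤ N)

-- a solution of x₁ + ⋯ + x_{m-1} = a·x_m in {1,…,N}, given as
-- xs : Fin (m-1) → ℕ (the variables x₁..x_{m-1}) and y (= x_m),
-- monochromatic in colour k under the colouring χ.
MonoSolution : (m a N : ℕ) → (χ : ℕ → Colour) → Set
MonoSolution m a N χ =
  Data.Product.Σ Colour λ k →
  Data.Product.Σ (Fin (m ∸ 1) → ℕ) λ xs →
  Data.Product.Σ ℕ λ y →
    ((i : Fin (m ∸ 1)) → InRange N (xs i) × (χ (xs i) ≡ k)) ×
    InRange N y × (χ y ≡ k) ×
    (ΣFin (m ∸ 1) xs ≡ a * y)

module Submission where

-- Write a = c + 2 and m = n + 3, so that m - 1 = n + 2 and the values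
-- a - 2, a - 1 are c, c + 1.  The proof exhibits explicit monochromatic
-- solutions of x₁ + ⋯ + x_{m-1} = a·x_m that the colouring would contain if
-- the conclusion failed.
--
--  * Block solutions: for d, r ≥ 0 put v = d + (d·c + r).  Then
--      (v, v, (c+1) repeated d·c times, c repeated r times ; x_m = v)
--    is a solution with m - 1 = 2 + d·c + r.  Taking d = 2, 1, 0 shows that
--    if c and c + 1 are red then m - 1, m - 2, m - 3 cannot be red.
--  * Constant solution: x₁ = ⋯ = x_{m-1} = a, x_m = m - 1.  As m - 1 is blue,
--    a cannot be blue.
--
-- All these values must lie in {1,…,C(m,a)}; the key estimate is
-- m - 1 ≤ C(m,a), which follows from ⌈(m-1)/a⌉ ≥ a.

open import Defs
open import Data.Nat using (ℕ; suc; zero; _+_; _*_; _∸_; _≤_; NonZero; z≤n; s≤s)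
open import Data.Nat.Properties
open import Data.Nat.DivMod using (m*n/n≡m; /-monoˡ-≤)
open import Data.Nat.Tactic.RingSolver using (solve-∀)
open import Data.Fin using (Fin; splitAt)
import Data.Fin as Fin
open import Data.Sum using (inj₁; inj₂)
open import Data.Product using (_×_; _,_)
open import Data.Vec.Functional using (Vector; _++_; replicate; tail)
open import Data.Vec.Functional.Relation.Unary.All using (All)
open import Data.Vec.Functional.Relation.Unary.All.Properties using (++⁺; replicate⁺)
open import Data.Empty using (⊥-elim)
open import Relation.Nullary using (¬_)
open import Relation.Binary.PropositionalEquality
  using (_≡_; _≢_; refl; sym; cong; cong₂; subst; module ≡-Reasoning)

open ≡-Reasoning

blue-if-not-red : {k : Colour} → k ≢ red → k ≡ blue
blue-if-not-red {red}  k≢red = ⊥-elim (k≢red refl)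
blue-if-not-red {blue} _     = refl

red-if-not-blue : {k : Colour} → k ≢ blue → k ≡ red
red-if-not-blue {red}  _      = refl
red-if-not-blue {blue} k≢blue = ⊥-elim (k≢blue refl)

ΣFin-cong : ∀ k {f g : Fin k → ℕ} → (∀ i → f i ≡ g i) → ΣFin k f ≡ ΣFin k g
ΣFin-cong zero    f≗g = refl
ΣFin-cong (suc k) f≗g = cong₂ _+_ (f≗g Fin.zero) (ΣFin-cong k (λ i → f≗g (Fin.suc i)))

++-lookup-suc : ∀ {m n} (xs : Vector ℕ (suc m)) (ys : Vector ℕ n) (i : Fin (m + n)) →
                (xs ++ ys) (Fin.suc i) ≡ (tail xs ++ ys) i
++-lookup-suc {m} xs ys i with splitAt m i
... | inj₁ _ = refl
... | inj₂ _ = refl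

ΣFin-++ : ∀ m {n} (xs : Vector ℕ m) (ys : Vector ℕ n) →
          ΣFin (m + n) (xs ++ ys) ≡ ΣFin m xs + ΣFin n ys
ΣFin-++ zero        xs ys = refl
ΣFin-++ (suc m) {n} xs ys = begin
  xs Fin.zero + ΣFin (m + n) (λ i → (xs ++ ys) (Fin.suc i))
    ≡⟨ cong (xs Fin.zero +_) (ΣFin-cong (m + n) (++-lookup-suc xs ys)) ⟩
  xs Fin.zero + ΣFin (m + n) (tail xs ++ ys)
    ≡⟨ cong (xs Fin.zero +_) (ΣFin-++ m (tail xs) ys) ⟩
  xs Fin.zero + (ΣFin m (tail xs) + ΣFin n ys)
    ≡⟨ sym (+-assoc (xs Fin.zero) _ _) ⟩
  ΣFin (suc m) xs + ΣFin n ys ∎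

ΣFin-replicate : ∀ k x → ΣFin k (replicate k x) ≡ k * x
ΣFin-replicate zero    x = refl
ΣFin-replicate (suc k) x = cong (x +_) (ΣFin-replicate k x)

⌈/⌉-lower : ∀ n a .{{_ : NonZero a}} k → k * a ≤ n + (a ∸ 1) → k ≤ ⌈ n / a ⌉
⌈/⌉-lower n a k ka≤ = subst (_≤ ⌈ n / a ⌉) (m*n/n≡m k a) (/-monoˡ-≤ a ka≤)

-- The key size estimate: if a² ≤ (m - 1) + (a - 1), i.e. ⌈(m-1)/a⌉ ≥ a,
-- then m - 1 ≤ C(m,a).  Here m = n + 1 and a = a' + 1.
C-lower : ∀ n a' → suc a' * suc a' ≤ n + a' → n ≤ C (suc n) (suc a')
C-lower n a' a²≤ = ⌈/⌉-lower (n * q) a n n*a≤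
  where
  a : ℕ
  a = suc a'
  q : ℕ
  q = ⌈ n / a ⌉
  a≤q : a ≤ q
  a≤q = ⌈/⌉-lower n a a a²≤
  n*a≤ : n * a ≤ n * q + a'
  n*a≤ = ≤-trans (*-monoʳ-≤ n a≤q) (m≤m+n (n * q) a')

Admissible : ℕ → (ℕ → Colour) → Colour → ℕ → Set
Admissible N χ k x = InRange N x × (χ x ≡ k)

constSolution : ∀ {N} χ k a n → Admissible N χ k a → Admissible N χ k n →
                MonoSolution (suc n) a N χ
constSolution {N} χ k a n adm-a (n∈ , χn) =
  k , replicate n a , n , replicate⁺ {P = Admissible N χ k} adm-a , n∈ , χn , sum≡
  where
  sum≡ : ΣFin n (replicate n a) ≡ a * n
  sum≡ = begin
    ΣFin n (replicate n a) ≡⟨ ΣFin-replicate n a ⟩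
    n * a                  ≡⟨ *-comm n a ⟩
    a * n                  ∎

block-identity : ∀ d c r →
  2 * (d + (d * c + r)) + ((d * c) * (1 + c) + r * c) ≡ (2 + c) * (d + (d * c + r))
block-identity = solve-∀

blockSolution : ∀ {N} χ k c d r → let v = d + (d * c + r) in
  Admissible N χ k v → Admissible N χ k c → Admissible N χ k (1 + c) →
  MonoSolution (3 + (d * c + r)) (2 + c) N χ
blockSolution {N} χ k c d r (v∈ , χv) adm-c adm-c+1 =
  k , xs , v , all-adm , v∈ , χv , sum≡
  where
  Adm : ℕ → Set
  Adm = Admissible N χ k
  v : ℕ
  v = d + (d * c + r)
  j : ℕ
  j = d * c
  xs : Vector ℕ (2 + (j + r))
  xs = replicate 2 v ++ (replicate j (1 + c) ++ replicate r c)
  all-adm : All Adm xs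
  all-adm = ++⁺ Adm {xs = replicate 2 v} (replicate⁺ {P = Adm} (v∈ , χv))
              (++⁺ Adm {xs = replicate j (1 + c)}
                (replicate⁺ {P = Adm} adm-c+1) (replicate⁺ {P = Adm} adm-c))
  sum≡ : ΣFin (2 + (j + r)) xs ≡ (2 + c) * v
  sum≡ = begin
    ΣFin (2 + (j + r)) xs
      ≡⟨ ΣFin-++ 2 (replicate 2 v) (replicate j (1 + c) ++ replicate r c) ⟩
    ΣFin 2 (replicate 2 v) + ΣFin (j + r) (replicate j (1 + c) ++ replicate r c)
      ≡⟨ cong (ΣFin 2 (replicate 2 v) +_) (ΣFin-++ j (replicate j (1 + c)) (replicate r c)) ⟩
    ΣFin 2 (replicate 2 v) + (ΣFin j (replicate j (1 + c)) + ΣFin r (replicate r c))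
      ≡⟨ cong₂ _+_ (ΣFin-replicate 2 v)
                   (cong₂ _+_ (ΣFin-replicate j (1 + c)) (ΣFin-replicate r c)) ⟩
    2 * v + (j * (1 + c) + r * c)
      ≡⟨ block-identity d c r ⟩
    (2 + c) * v ∎

blockSolution′ : ∀ {N} χ k c d n → d * c ≤ n →
  Admissible N χ k (d + n) → Admissible N χ k c → Admissible N χ k (1 + c) →
  MonoSolution (3 + n) (2 + c) N χ
blockSolution′ χ k c d n dc≤n with r , refl ← m≤n⇒∃[o]m+o≡n dc≤n =
  blockSolution χ k c d r

forcedColours : ∀ c n (χ : ℕ → Colour) → 1 ≤ c → 2 * c ≤ n →
  (2 + c) * (2 + c) ≤ (2 + n) + (1 + c) →
  ¬ MonoSolution (3 + n) (2 + c) (C (3 + n) (2 + c)) χ →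
  χ c ≡ red → χ (1 + c) ≡ red →
  (χ (2 + n) ≡ blue × χ (1 + n) ≡ blue × χ n ≡ blue) × χ (2 + c) ≡ red
forcedColours c n χ 1≤c 2c≤n a²≤ noMono χc χc+1 =
  (blue-if-not-red (notRed 2 ≤-refl) , blue-if-not-red (notRed 1 (n≤1+n 1)) ,
   blue-if-not-red (notRed 0 z≤n)) , red-if-not-blue aNotBlue
  where
  N : ℕ
  N = C (3 + n) (2 + c)
  inRange : ∀ x → 1 ≤ x → x ≤ 2 + n → InRange N x
  inRange x 1≤x x≤ = 1≤x , ≤-trans x≤ (C-lower (2 + n) (1 + c) a²≤)
  c≤n : c ≤ n
  c≤n = ≤-trans (m≤m+n c (c + 0)) 2c≤n
  adm-c : Admissible N χ red c
  adm-c = inRange c 1≤c (≤-trans c≤n (m≤n+m n 2)) , χc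
  adm-c+1 : Admissible N χ red (1 + c)
  adm-c+1 = inRange (1 + c) (s≤s z≤n) (s≤s (≤-trans c≤n (n≤1+n n))) , χc+1
  notRed : ∀ d → d ≤ 2 → χ (d + n) ≢ red
  notRed d d≤2 χv = noMono (blockSolution′ χ red c d n (≤-trans (*-monoˡ-≤ c d≤2) 2c≤n)
    (inRange (d + n) (≤-trans 1≤c (≤-trans c≤n (m≤n+m n d))) (+-monoˡ-≤ n d≤2) , χv) adm-c adm-c+1)
  aNotBlue : χ (2 + c) ≢ blue
  aNotBlue χa = noMono (constSolution χ blue (2 + c) (2 + n)
    (inRange (2 + c) (s≤s z≤n) (s≤s (s≤s c≤n)) , χa)
    (inRange (2 + n) (s≤s z≤n) ≤-refl , blue-if-not-red (notRed 2 ≤-refl)))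

-- For a = b + 3 the hypothesis m ≥ 2a² - a + 2 says m - 3 ≥ threshold b.
threshold : ℕ → ℕ
threshold b = 14 + 11 * b + 2 * (b * b)

twice-square : ∀ b → 2 * (3 + b) * (3 + b) ≡ (3 + b) + (15 + 11 * b + 2 * (b * b))
twice-square = solve-∀

threshold-shift : ∀ b → 15 + 11 * b + 2 * (b * b) + 2 ≡ 3 + (14 + 11 * b + 2 * (b * b))
threshold-shift = solve-∀

threshold-split₁ : ∀ b → 2 * (1 + b) + (12 + 9 * b + 2 * (b * b)) ≡ 14 + 11 * b + 2 * (b * b)
threshold-split₁ = solve-∀

threshold-split₂ : ∀ b → (3 + b) * (3 + b) + (5 + 5 * b + b * b) ≡ 14 + 11 * b + 2 * (b * b)
threshold-split₂ = solve-∀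

summand-≤ : ∀ x y {z n} → x + y ≡ z → z ≤ n → x ≤ n
summand-≤ x y refl = m+n≤o⇒m≤o x

hypothesis-threshold : ∀ b m → 2 * (3 + b) * (3 + b) ∸ (3 + b) + 2 ≤ m → 3 + threshold b ≤ m
hypothesis-threshold b m = subst (_≤ m) lhs≡
  where
  a : ℕ
  a = 3 + b
  lhs≡ : 2 * a * a ∸ a + 2 ≡ 3 + threshold b
  lhs≡ = begin
    2 * a * a ∸ a + 2                         ≡⟨ cong (λ t → t ∸ a + 2) (twice-square b) ⟩
    a + (15 + 11 * b + 2 * (b * b)) ∸ a + 2   ≡⟨ cong (_+ 2) (m+n∸m≡n a _) ⟩
    15 + 11 * b + 2 * (b * b) + 2             ≡⟨ threshold-shift b ⟩
    3 + threshold b                           ∎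

threshold⇒linear : ∀ b n → threshold b ≤ n → 2 * (1 + b) ≤ n
threshold⇒linear b n = summand-≤ (2 * (1 + b)) _ (threshold-split₁ b)

threshold⇒square : ∀ b n → threshold b ≤ n → (3 + b) * (3 + b) ≤ (2 + n) + (2 + b)
threshold⇒square b n t≤n =
  ≤-trans (summand-≤ ((3 + b) * (3 + b)) _ (threshold-split₂ b) t≤n)
          (≤-trans (m≤n+m n 2) (m≤m+n (2 + n) (2 + b)))

forcedColours-threshold : ∀ b m (χ : ℕ → Colour) → 3 + threshold b ≤ m →
  ¬ MonoSolution m (3 + b) (C m (3 + b)) χ →
  χ (1 + b) ≡ red → χ (2 + b) ≡ red →
  (χ (m ∸ 1) ≡ blue × χ (m ∸ 2) ≡ blue × χ (m ∸ 3) ≡ blue) × χ (3 + b) ≡ red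
forcedColours-threshold b (suc (suc (suc n))) χ (s≤s (s≤s (s≤s t≤n))) =
  forcedColours (1 + b) n χ (s≤s z≤n) (threshold⇒linear b n t≤n) (threshold⇒square b n t≤n)

lemma4 : (a m : ℕ) → (ha : 3 ≤ a) → (hm : 2 * a * a ∸ a + 2 ≤ m) →
         (χ : ℕ → Colour) →
         ¬ MonoSolution m a (C m a) χ →
         χ (a ∸ 2) ≡ red → χ (a ∸ 1) ≡ red →
         (χ (m ∸ 1) ≡ blue × χ (m ∸ 2) ≡ blue × χ (m ∸ 3) ≡ blue) × χ a ≡ red
lemma4 (suc (suc (suc b))) m (s≤s (s≤s (s≤s z≤n))) hm χ =
  forcedColours-threshold b m χ (hypothesis-threshold b m hm)
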